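{- Let $f\in\#\mathsf{FA}$, $f:\Sigma^\star\to\mathbb{N}$, and let $\varphi:\mathbb{Q}\to\mathbb{Q}$ be an integer-valued polynomial. Then the function $w\mapsto\max(\varphi(f(w)),0)$ is in $\#\mathsf{FA}$.
   Context: $\mathbb{N}=\{0,1,2,\dots\}$. An NFA is a tuple $M=(Q,\Sigma,\mathrm{wt},\mathrm{in},\mathrm{out})$ with $Q,\Sigma$ finite, $\mathrm{wt}:Q\times\Sigma\times Q\to\mathbb{N}$, $\mathrm{in},\mathrm{out}:Q\to\mathbb{N}$; on input $w=w_1\cdots w_n$ it outputs $\sum_{q_0,\dots,q_n\in Q}\mathrm{in}(q_0)\prod_{i=1}^n\mathrm{wt}(q_{i-1},w_i,q_i)\mathrm{out}(q_n)$. $\#\mathsf{FA}$ is the set of functions $\Sigma^\star\to\mathbb{N}$ (over finite alphabets $\Sigma$) computed by NFAs. A polynomial is integer-valued if it maps $\mathbb{Z}$ into $\mathbb{Z}$. -}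

module Defs where

open import Data.Nat using (ℕ; zero; suc; _+_; _*_)
open import Data.Fin using (Fin)
open import Data.List using (List; []; _∷_; foldr)
open import Data.Integer using (ℤ)
open import Data.Rational using (ℚ; _/_; 0ℚ) renaming (_+_ to _+ℚ_; _*_ to _*ℚ_)
open import Data.Product using (∃)
open import Relation.Binary.PropositionalEquality using (_≡_)

sumFin : (n : ℕ) → (Fin n → ℕ) → ℕ
sumFin zero    g = 0
sumFin (suc n) g = g Fin.zero + sumFin n (λ i → g (Fin.suc i))

record NFA (k : ℕ) : Set where
  field
    states : ℕ
    wt     : Fin states → Fin k → Fin states → ℕ
    inw    : Fin states → ℕ
    outw   : Fin states → ℕ

module _ {k : ℕ} (M : NFA k) where
  open NFA M
  runFrom : Fin states → List (Fin k) → ℕ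
  runFrom q []      = outw q
  runFrom q (a ∷ w) = sumFin states (λ q' → wt q a q' * runFrom q' w)

  ⟦_⟧ : List (Fin k) → ℕ
  ⟦_⟧ w = sumFin states (λ q → inw q * runFrom q w)

InSharpFA : {k : ℕ} → (List (Fin k) → ℕ) → Set
InSharpFA {k} f = ∃ λ (M : NFA k) → ∀ w → ⟦ M ⟧ w ≡ f w

-- polynomials over ℚ as coefficient lists (constant term first)
Poly : Set
Poly = List ℚ

evalPoly : Poly → ℚ → ℚ
evalPoly p x = foldr (λ c acc → c +ℚ (x *ℚ acc)) 0ℚ p

ℤ→ℚ : ℤ → ℚ
ℤ→ℚ z = z / 1

ℕ→ℚ : ℕ → ℚ
ℕ→ℚ n = ℤ→ℚ (ℤ.pos n)

IntegerValued : Poly → Set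
IntegerValued p = ∀ (z : ℤ) → ∃ λ (m : ℤ) → evalPoly p (ℤ→ℚ z) ≡ ℤ→ℚ m

-- Let p n = max (φ n, 0). The Newton coefficients of φ at an integer are integers, and moving the base
-- point far enough to the right makes them all of one sign; so p (N + x) = ∑ᵢ dᵢ (x C i) for some N and
-- natural numbers dᵢ. For f = ⟦ M ⟧, every binomial (f w C i) is #FA: by Vandermonde's identity, the
-- products of binomials of the state counts form a finite family closed under reading a letter. For the
-- values below N, an automaton guesses and verifies, reading from the end of the word, the vector of state
-- counts truncated at N. This vector determines one part of f w; the other part is #FA and vanishes unless
-- the first already reaches N. Hence p (f w) is a finite sum of products of #FA functions.
module Submission where

open import Data.Fin using (Fin)
import Data.Fin as Fin
open import Data.Integer using (ℤ; 0ℤ)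
import Data.Integer as ℤ
import Data.Integer.Properties as ℤ
open import Data.List using (List; []; _∷_; _++_; map; concatMap; replicate; length; lookup; tabulate;
  allFin; upTo; cartesianProduct; cartesianProductWith; deduplicate)
open import Data.List.Membership.Propositional using (_∈_)
open import Data.List.Membership.Propositional.Properties using (∈-map⁺; ∈-concat⁺′; ∈-tabulate⁺;
  ∈-applyUpTo⁺; ∈-cartesianProductWith⁺; ∈-deduplicate⁺; ∈-deduplicate⁻)
open import Data.List.Properties using (≡-dec)
open import Data.List.Relation.Unary.All using (All; []; _∷_) renaming (lookup to lookupᴬ)
import Data.List.Relation.Unary.All as All
import Data.List.Relation.Unary.All.Properties as All
open import Data.List.Relation.Unary.AllPairs using ([]; _∷_)
open import Data.List.Relation.Unary.Any using (Any; here; there)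
open import Data.List.Relation.Unary.Unique.DecPropositional.Properties using (deduplicate-!)
open import Data.List.Relation.Unary.Unique.Propositional using (Unique)
open import Data.Maybe using (Maybe; nothing; just)
open import Data.Nat using (ℕ; zero; suc; _+_; _*_; _∸_; _⊓_; _≤_; _<_; _≤?_; z≤n; s≤s)
import Data.Nat as ℕ
open import Data.Nat.Combinatorics using (_C_; nCk+nC[k+1]≡[n+1]C[k+1])
open import Data.Nat.Properties
open import Algebra.Properties.CommutativeSemigroup +-commutativeSemigroup using ()
  renaming (interchange to +-interchange; x∙yz≈y∙xz to +-left-comm)
open import Algebra.Properties.CommutativeSemigroup *-commutativeSemigroup using ()
  renaming (interchange to *-interchange; x∙yz≈y∙xz to *-left-comm)
open import Data.Nat.Tactic.RingSolver using (solve-∀)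
open import Data.Product using (∃; _×_; _,_; proj₁; proj₂; map₁)
open import Data.Product.Properties using () renaming (≡-dec to ×-≡-dec)
open import Data.Rational using (ℚ; _⊔_; 0ℚ; 1ℚ)
import Data.Rational
open import Data.Sum using (_⊎_; inj₁; inj₂; [_,_])
open import Data.Unit using (⊤; tt)
open import Data.Vec using (Vec)
import Data.Vec as Vec
import Data.Vec.Properties as Vec
open import Function using (_∘_; id)
open import Relation.Binary.Definitions using (DecidableEquality)
open import Relation.Binary.PropositionalEquality hiding ([_])
open import Relation.Nullary using (Dec; yes; no; contradiction)

open import Defs

open ≡-Reasoning

private
  variable
    A B : Set

∑ : List A → (A → ℕ) → ℕ
∑ []       h = 0
∑ (x ∷ xs) h = h x + ∑ xs h

syntax ∑ xs (λ x → e) = ∑[ x ∈ xs ] e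

∑-cong-∈ : ∀ (xs : List A) {h g} → (∀ {x} → x ∈ xs → h x ≡ g x) → ∑ xs h ≡ ∑ xs g
∑-cong-∈ []       e = refl
∑-cong-∈ (x ∷ xs) e = cong₂ _+_ (e (here refl)) (∑-cong-∈ xs (e ∘ there))

∑-cong : ∀ (xs : List A) {h g} → (∀ x → h x ≡ g x) → ∑ xs h ≡ ∑ xs g
∑-cong xs e = ∑-cong-∈ xs (λ {x} _ → e x)

∑-zero : ∀ (xs : List A) → ∑[ x ∈ xs ] 0 ≡ 0
∑-zero []       = refl
∑-zero (x ∷ xs) = ∑-zero xs

∑-++ : ∀ (xs ys : List A) h → ∑ (xs ++ ys) h ≡ ∑ xs h + ∑ ys h
∑-++ []       ys h = refl
∑-++ (x ∷ xs) ys h = trans (cong (h x +_) (∑-++ xs ys h)) (sym (+-assoc (h x) _ _))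

∑-distrib-+ : ∀ (xs : List A) h g → ∑[ x ∈ xs ] (h x + g x) ≡ ∑ xs h + ∑ xs g
∑-distrib-+ []       h g = refl
∑-distrib-+ (x ∷ xs) h g =
  trans (cong (h x + g x +_) (∑-distrib-+ xs h g)) (+-interchange (h x) (g x) (∑ xs h) (∑ xs g))

*-distribˡ-∑ : ∀ c (xs : List A) h → c * ∑ xs h ≡ ∑[ x ∈ xs ] (c * h x)
*-distribˡ-∑ c []       h = *-zeroʳ c
*-distribˡ-∑ c (x ∷ xs) h = trans (*-distribˡ-+ c (h x) _) (cong (c * h x +_) (*-distribˡ-∑ c xs h))

*-distribʳ-∑ : ∀ c (xs : List A) h → ∑ xs h * c ≡ ∑[ x ∈ xs ] (h x * c)
*-distribʳ-∑ c xs h =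
  trans (*-comm (∑ xs h) c) (trans (*-distribˡ-∑ c xs h) (∑-cong xs (λ x → *-comm c (h x))))

∑-replicate : ∀ n (x : A) h → ∑ (replicate n x) h ≡ n * h x
∑-replicate zero    x h = refl
∑-replicate (suc n) x h = cong (h x +_) (∑-replicate n x h)

∑-map : ∀ (f : A → B) xs h → ∑ (map f xs) h ≡ ∑[ x ∈ xs ] h (f x)
∑-map f []       h = refl
∑-map f (x ∷ xs) h = cong (h (f x) +_) (∑-map f xs h)

∑-concatMap : ∀ (f : A → List B) xs h → ∑ (concatMap f xs) h ≡ ∑[ x ∈ xs ] ∑ (f x) h
∑-concatMap f []       h = refl
∑-concatMap f (x ∷ xs) h = trans (∑-++ (f x) (concatMap f xs) h) (cong (∑ (f x) h +_) (∑-concatMap f xs h))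

∑-cartesianProduct : ∀ xs ys (h : A × B → ℕ) → ∑ (cartesianProduct xs ys) h ≡ ∑[ x ∈ xs ] ∑[ y ∈ ys ] h (x , y)
∑-cartesianProduct []       ys h = refl
∑-cartesianProduct (x ∷ xs) ys h =
  trans (∑-++ (map (x ,_) ys) _ h) (cong₂ _+_ (∑-map (x ,_) ys h) (∑-cartesianProduct xs ys h))

∑-comm : ∀ xs ys (h : A → B → ℕ) → ∑[ x ∈ xs ] ∑[ y ∈ ys ] h x y ≡ ∑[ y ∈ ys ] ∑[ x ∈ xs ] h x y
∑-comm []       ys h = sym (∑-zero ys)
∑-comm (x ∷ xs) ys h = trans (cong (∑ ys (h x) +_) (∑-comm xs ys h)) (sym (∑-distrib-+ ys (h x) _))

∑*∑ : ∀ xs ys (h : A → ℕ) (g : B → ℕ) → ∑ xs h * ∑ ys g ≡ ∑[ x ∈ xs ] ∑[ y ∈ ys ] (h x * g y)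
∑*∑ xs ys h g = trans (*-distribʳ-∑ (∑ ys g) xs h) (∑-cong xs (λ x → *-distribˡ-∑ (h x) ys g))

∑-⊎ : ∀ (xs : List A) (ys : List B) h → ∑ (map inj₁ xs ++ map inj₂ ys) h ≡ ∑[ x ∈ xs ] h (inj₁ x) + ∑[ y ∈ ys ] h (inj₂ y)
∑-⊎ xs ys h = trans (∑-++ (map inj₁ xs) _ h) (cong₂ _+_ (∑-map inj₁ xs h) (∑-map inj₂ ys h))

multiset : (A → ℕ) → List A → List A
multiset c = concatMap (λ x → replicate (c x) x)

∑-multiset : ∀ c (xs : List A) h → ∑ (multiset c xs) h ≡ ∑[ x ∈ xs ] (c x * h x)
∑-multiset c xs h = trans (∑-concatMap _ xs h) (∑-cong xs (λ x → ∑-replicate (c x) x h))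

∑-tabulate : ∀ n (f : Fin n → A) h → ∑ (tabulate f) h ≡ sumFin n (λ i → h (f i))
∑-tabulate zero    f h = refl
∑-tabulate (suc n) f h = cong (h (f Fin.zero) +_) (∑-tabulate n (λ i → f (Fin.suc i)) h)

sumFin-cong : ∀ n {h g : Fin n → ℕ} → (∀ i → h i ≡ g i) → sumFin n h ≡ sumFin n g
sumFin-cong zero    e = refl
sumFin-cong (suc n) e = cong₂ _+_ (e Fin.zero) (sumFin-cong n (λ i → e (Fin.suc i)))

sumFin-lookup : ∀ (xs : List A) h → sumFin (length xs) (h ∘ lookup xs) ≡ ∑ xs h
sumFin-lookup []       h = refl
sumFin-lookup (x ∷ xs) h = cong (h x +_) (sumFin-lookup xs h)

∈-concatMap⁺′ : ∀ {f : A → List B} {x xs y} → y ∈ f x → x ∈ xs → y ∈ concatMap f xs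
∈-concatMap⁺′ {f = f} y∈ x∈ = ∈-concat⁺′ y∈ (∈-map⁺ f x∈)

𝟙 : {P : Set} → Dec P → ℕ
𝟙 (yes _) = 1
𝟙 (no _)  = 0

𝟙-*-cong : ∀ {P : Set} (d : Dec P) {x y} → (P → x ≡ y) → 𝟙 d * x ≡ 𝟙 d * y
𝟙-*-cong (yes p) x≡y = cong (1 *_) (x≡y p)
𝟙-*-cong (no _)  _   = refl

module _ (_≟_ : DecidableEquality A) where

  ∑-𝟙-∉ : ∀ {xs : List A} x (h : A → ℕ) → All (x ≢_) xs → ∑[ t ∈ xs ] (𝟙 (t ≟ x) * h t) ≡ 0
  ∑-𝟙-∉ x h []                 = refl
  ∑-𝟙-∉ x h (_∷_ {t} x≢t x∉) with t ≟ x
  ... | yes t≡x = contradiction (sym t≡x) x≢t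
  ... | no _    = ∑-𝟙-∉ x h x∉

  ∑-𝟙 : ∀ {xs : List A} {x} (h : A → ℕ) → Unique xs → x ∈ xs → ∑[ t ∈ xs ] (𝟙 (t ≟ x) * h t) ≡ h x
  ∑-𝟙 {x ∷ xs} h (x∉ ∷ _) (here refl) with x ≟ x
  ... | yes _   = trans (cong₂ _+_ (+-identityʳ (h x)) (∑-𝟙-∉ x h x∉)) (+-identityʳ (h x))
  ... | no x≢x  = contradiction refl x≢x
  ∑-𝟙 {y ∷ xs} {x} h (y∉ ∷ u) (there x∈) with y ≟ x
  ... | yes refl = contradiction refl (lookupᴬ y∉ x∈)
  ... | no _     = ∑-𝟙 h u x∈

  ∑-count : ∀ {xs ys : List A} (h : A → ℕ) → Unique xs → All (_∈ xs) ys →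
            ∑[ t ∈ xs ] (∑[ y ∈ ys ] 𝟙 (t ≟ y) * h t) ≡ ∑ ys h
  ∑-count {xs} {ys} h u ys⊆xs = begin
    ∑[ t ∈ xs ] (∑[ y ∈ ys ] 𝟙 (t ≟ y) * h t)   ≡⟨ ∑-cong xs (λ t → *-distribʳ-∑ (h t) ys _) ⟩
    ∑[ t ∈ xs ] ∑[ y ∈ ys ] (𝟙 (t ≟ y) * h t)   ≡⟨ ∑-comm xs ys _ ⟩
    ∑[ y ∈ ys ] ∑[ t ∈ xs ] (𝟙 (t ≟ y) * h t)   ≡⟨ ∑-cong-∈ ys (λ y∈ → ∑-𝟙 h u (lookupᴬ ys⊆xs y∈)) ⟩
    ∑ ys h                                      ∎

-- Weighted automata with a listed state set

record Automaton (k : ℕ) : Set₁ where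
  field
    State  : Set
    states : List State
    wt     : State → Fin k → State → ℕ
    inw    : State → ℕ
    outw   : State → ℕ

  run : State → List (Fin k) → ℕ
  run s []      = outw s
  run s (a ∷ w) = ∑[ t ∈ states ] (wt s a t * run t w)

  eval : List (Fin k) → ℕ
  eval w = ∑[ s ∈ states ] (inw s * run s w)

  module _ (val : State → List (Fin k) → ℕ)
           (val-[] : ∀ {s} → s ∈ states → val s [] ≡ outw s)
           (val-∷ : ∀ {s} a w → s ∈ states → val s (a ∷ w) ≡ ∑[ t ∈ states ] (wt s a t * val t w))
           where

    run-unique : ∀ {s} w → s ∈ states → run s w ≡ val s w
    run-unique []      s∈ = sym (val-[] s∈)
    run-unique (a ∷ w) s∈ =
      trans (∑-cong-∈ states (λ t∈ → cong (wt _ a _ *_) (run-unique w t∈))) (sym (val-∷ a w s∈))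

    eval-unique : ∀ w → eval w ≡ ∑[ s ∈ states ] (inw s * val s w)
    eval-unique w = ∑-cong-∈ states (λ s∈ → cong (inw _ *_) (run-unique w s∈))

open Automaton using (run; eval)

module _ {k : ℕ} where

  toNFA : Automaton k → NFA k
  toNFA A = record
    { states = length states
    ; wt     = λ i a j → wt (lookup states i) a (lookup states j)
    ; inw    = inw ∘ lookup states
    ; outw   = outw ∘ lookup states
    }
    where open Automaton A hiding (run; eval)

  fromNFA : NFA k → Automaton k
  fromNFA M = record { State = Fin states ; states = allFin states ; wt = wt ; inw = inw ; outw = outw }
    where open NFA M

  runFrom-toNFA : ∀ (A : Automaton k) i w → runFrom (toNFA A) i w ≡ run A (lookup (Automaton.states A) i) w
  runFrom-toNFA A i []      = refl
  runFrom-toNFA A i (a ∷ w) =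
    trans (sumFin-cong (length states) (λ j → cong (wt (lookup states i) a (lookup states j) *_) (runFrom-toNFA A j w)))
          (sumFin-lookup states (λ t → wt (lookup states i) a t * run A t w))
    where open Automaton A hiding (run; eval)

  ⟦toNFA⟧ : ∀ (A : Automaton k) w → ⟦ toNFA A ⟧ w ≡ eval A w
  ⟦toNFA⟧ A w =
    trans (sumFin-cong (length states) (λ j → cong (inw (lookup states j) *_) (runFrom-toNFA A j w)))
          (sumFin-lookup states (λ s → inw s * run A s w))
    where open Automaton A hiding (run; eval)

  run-fromNFA : ∀ (M : NFA k) q w → run (fromNFA M) q w ≡ runFrom M q w
  run-fromNFA M q []      = refl
  run-fromNFA M q (a ∷ w) =
    trans (∑-tabulate states _ _) (sumFin-cong states (λ t → cong (wt q a t *_) (run-fromNFA M t w)))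
    where open NFA M

  eval-fromNFA : ∀ (M : NFA k) w → eval (fromNFA M) w ≡ ⟦ M ⟧ w
  eval-fromNFA M w =
    trans (∑-tabulate states _ _) (sumFin-cong states (λ q → cong (inw q *_) (run-fromNFA M q w)))
    where open NFA M

  #FA-ext : ∀ {f g : List (Fin k) → ℕ} → (∀ w → f w ≡ g w) → InSharpFA f → InSharpFA g
  #FA-ext f≗g (M , ⟦M⟧≗f) = M , λ w → trans (⟦M⟧≗f w) (f≗g w)

  eval-#FA : ∀ (A : Automaton k) → InSharpFA (eval A)
  eval-#FA A = toNFA A , ⟦toNFA⟧ A

  #FA⇒eval : ∀ {f : List (Fin k) → ℕ} → InSharpFA f → ∃ λ (A : Automaton k) → ∀ w → eval A w ≡ f w
  #FA⇒eval (M , ⟦M⟧≗f) = fromNFA M , λ w → trans (eval-fromNFA M w) (⟦M⟧≗f w)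

module _ {k : ℕ} where

  constant : ℕ → Automaton k
  constant c = record { State = ⊤ ; states = tt ∷ [] ; wt = λ _ _ _ → 1 ; inw = λ _ → c ; outw = λ _ → 1 }

  eval-constant : ∀ c w → eval (constant c) w ≡ c
  eval-constant c w =
    trans (Automaton.eval-unique (constant c) (λ _ _ → 1) (λ _ → refl) (λ _ _ _ → refl) w)
          (trans (+-identityʳ (c * 1)) (*-identityʳ c))

  _⊕_ : Automaton k → Automaton k → Automaton k
  A ⊕ B = record
    { State  = A.State ⊎ B.State
    ; states = map inj₁ A.states ++ map inj₂ B.states
    ; wt     = wt
    ; inw    = [ A.inw , B.inw ]
    ; outw   = [ A.outw , B.outw ]
    }
    where
    module A = Automaton A
    module B = Automaton B
    wt : A.State ⊎ B.State → Fin k → A.State ⊎ B.State → ℕ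
    wt (inj₁ s) a (inj₁ t) = A.wt s a t
    wt (inj₂ s) a (inj₂ t) = B.wt s a t
    wt _        a _        = 0

  eval-⊕ : ∀ A B w → eval (A ⊕ B) w ≡ eval A w + eval B w
  eval-⊕ A B w = trans (Automaton.eval-unique (A ⊕ B) val val-[] val-∷ w) (∑-⊎ A.states B.states _)
    where
    module A = Automaton A
    module B = Automaton B
    module A⊕B = Automaton (A ⊕ B)

    val : A⊕B.State → List (Fin k) → ℕ
    val = [ run A , run B ]

    val-[] : ∀ {s} → s ∈ A⊕B.states → val s [] ≡ A⊕B.outw s
    val-[] {inj₁ _} _ = refl
    val-[] {inj₂ _} _ = refl

    val-∷ : ∀ {s} a w → s ∈ A⊕B.states → val s (a ∷ w) ≡ ∑[ t ∈ A⊕B.states ] (A⊕B.wt s a t * val t w)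
    val-∷ {inj₁ s} a w _ = sym (trans (∑-⊎ A.states B.states _)
                                      (trans (cong (run A s (a ∷ w) +_) (∑-zero B.states)) (+-identityʳ _)))
    val-∷ {inj₂ s} a w _ = sym (trans (∑-⊎ A.states B.states _) (cong (_+ run B s (a ∷ w)) (∑-zero A.states)))

  _⊗_ : Automaton k → Automaton k → Automaton k
  A ⊗ B = record
    { State  = A.State × B.State
    ; states = cartesianProduct A.states B.states
    ; wt     = λ (s , s′) a (t , t′) → A.wt s a t * B.wt s′ a t′
    ; inw    = λ (s , s′) → A.inw s * B.inw s′
    ; outw   = λ (s , s′) → A.outw s * B.outw s′
    }
    where
    module A = Automaton A
    module B = Automaton B

  module _ (A B : Automaton k) where
    private
      module A = Automaton A
      module B = Automaton B

    ∑⊗∑ : ∀ (c : A.State → ℕ) (d : B.State → ℕ) w →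
          ∑[ s ∈ A.states ] (c s * run A s w) * ∑[ s′ ∈ B.states ] (d s′ * run B s′ w) ≡
          ∑ (cartesianProduct A.states B.states) (λ (s , s′) → (c s * d s′) * (run A s w * run B s′ w))
    ∑⊗∑ c d w = begin
      ∑[ s ∈ A.states ] (c s * run A s w) * ∑[ s′ ∈ B.states ] (d s′ * run B s′ w)
        ≡⟨ ∑*∑ A.states B.states _ _ ⟩
      ∑[ s ∈ A.states ] ∑[ s′ ∈ B.states ] ((c s * run A s w) * (d s′ * run B s′ w))
        ≡⟨ ∑-cong A.states (λ s → ∑-cong B.states (λ s′ → *-interchange (c s) (run A s w) (d s′) (run B s′ w))) ⟩
      ∑[ s ∈ A.states ] ∑[ s′ ∈ B.states ] ((c s * d s′) * (run A s w * run B s′ w))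
        ≡⟨ sym (∑-cartesianProduct A.states B.states _) ⟩
      ∑ (cartesianProduct A.states B.states) (λ (s , s′) → (c s * d s′) * (run A s w * run B s′ w)) ∎

    eval-⊗ : ∀ w → eval (A ⊗ B) w ≡ eval A w * eval B w
    eval-⊗ w = trans (Automaton.eval-unique (A ⊗ B) (λ (s , s′) w → run A s w * run B s′ w) (λ _ → refl)
                       (λ {(s , s′)} a w _ → ∑⊗∑ (A.wt s a) (B.wt s′ a) w) w)
                     (sym (∑⊗∑ A.inw B.inw w))

module _ {k : ℕ} where

  private
    variable
      f g : List (Fin k) → ℕ

  #FA-const : ∀ c → InSharpFA {k} (λ _ → c)
  #FA-const c = #FA-ext (eval-constant c) (eval-#FA (constant c))

  #FA-lift₂ : ∀ (_∙_ : ℕ → ℕ → ℕ) (_⊙_ : Automaton k → Automaton k → Automaton k) →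
              (∀ A B w → eval (A ⊙ B) w ≡ eval A w ∙ eval B w) →
              InSharpFA f → InSharpFA g → InSharpFA (λ w → f w ∙ g w)
  #FA-lift₂ _∙_ _⊙_ eval-⊙ f∈ g∈ =
    let (A , A≗f) = #FA⇒eval f∈
        (B , B≗g) = #FA⇒eval g∈
    in #FA-ext (λ w → trans (eval-⊙ A B w) (cong₂ _∙_ (A≗f w) (B≗g w))) (eval-#FA (A ⊙ B))

  #FA-+ : InSharpFA f → InSharpFA g → InSharpFA (λ w → f w + g w)
  #FA-+ = #FA-lift₂ _+_ _⊕_ eval-⊕

  #FA-* : InSharpFA f → InSharpFA g → InSharpFA (λ w → f w * g w)
  #FA-* = #FA-lift₂ _*_ _⊗_ eval-⊗

  #FA-scale : ∀ c → InSharpFA f → InSharpFA (λ w → c * f w)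
  #FA-scale c = #FA-* (#FA-const c)

  #FA-∑ : ∀ (xs : List A) {F : A → List (Fin k) → ℕ} → (∀ x → InSharpFA (F x)) →
          InSharpFA (λ w → ∑[ x ∈ xs ] F x w)
  #FA-∑ []       F∈ = #FA-const 0
  #FA-∑ (x ∷ xs) F∈ = #FA-+ (F∈ x) (#FA-∑ xs F∈)

module ClosedFamily {k : ℕ} {L : Set} (_≟_ : DecidableEquality L)
         (labels : List L) (labels-unique : Unique labels)
         (val : L → List (Fin k) → ℕ) (expand : Fin k → L → List L)
         (expand-closed : ∀ a {ℓ} → ℓ ∈ labels → All (_∈ labels) (expand a ℓ))
         (val-∷ : ∀ a {ℓ} w → ℓ ∈ labels → val ℓ (a ∷ w) ≡ ∑[ ℓ′ ∈ expand a ℓ ] val ℓ′ w)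
         where

  #FA-span : ∀ (start : List L) → All (_∈ labels) start → InSharpFA (λ w → ∑[ ℓ ∈ start ] val ℓ w)
  #FA-span start start⊆ = #FA-ext eval≗ (eval-#FA automaton)
    where
    multiplicity : List L → L → ℕ
    multiplicity ℓs ℓ = ∑[ ℓ′ ∈ ℓs ] 𝟙 (ℓ ≟ ℓ′)

    automaton : Automaton k
    automaton = record { State = L ; states = labels ; wt = λ ℓ a → multiplicity (expand a ℓ)
                       ; inw = multiplicity start ; outw = λ ℓ → val ℓ [] }

    eval≗ : ∀ w → eval automaton w ≡ ∑[ ℓ ∈ start ] val ℓ w
    eval≗ w = trans (Automaton.eval-unique automaton val (λ _ → refl)
                      (λ a w ℓ∈ → trans (val-∷ a w ℓ∈)
                        (sym (∑-count _≟_ (λ ℓ′ → val ℓ′ w) labels-unique (expand-closed a ℓ∈)))) w)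
                    (∑-count _≟_ (λ ℓ → val ℓ w) labels-unique start⊆)

-- Binomial coefficients of #FA functions

antidiagonal : ℕ → List (ℕ × ℕ)
antidiagonal zero    = (0 , 0) ∷ []
antidiagonal (suc g) = (0 , suc g) ∷ map (map₁ suc) (antidiagonal g)

antidiagonal-complete : ∀ i j → (i , j) ∈ antidiagonal (i + j)
antidiagonal-complete zero    zero    = here refl
antidiagonal-complete zero    (suc j) = here refl
antidiagonal-complete (suc i) j       = there (∈-map⁺ (map₁ suc) (antidiagonal-complete i j))

antidiagonal-sum : ∀ g → All (λ (i , j) → i + j ≡ g) (antidiagonal g)
antidiagonal-sum zero    = refl ∷ []
antidiagonal-sum (suc g) = refl ∷ All.map⁺ (All.map (cong suc) (antidiagonal-sum g))

∑-antidiagonal-suc : ∀ g h → ∑ (antidiagonal (suc g)) h ≡ h (0 , suc g) + ∑ (antidiagonal g) (λ (i , j) → h (suc i , j))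
∑-antidiagonal-suc g h = cong (h (0 , suc g) +_) (∑-map (map₁ suc) (antidiagonal g) h)

vandermonde : ∀ x y g → (x + y) C g ≡ ∑ (antidiagonal g) (λ (i , j) → (x C i) * (y C j))
vandermonde x       y zero    = refl
vandermonde zero    y (suc g) = sym (begin
  ∑ (antidiagonal (suc g)) (λ (i , j) → (0 C i) * (y C j))  ≡⟨ ∑-antidiagonal-suc g (λ (i , j) → (0 C i) * (y C j)) ⟩
  (y C suc g) + 0 + ∑[ ij ∈ antidiagonal g ] 0             ≡⟨ cong ((y C suc g) + 0 +_) (∑-zero (antidiagonal g)) ⟩
  (y C suc g) + 0 + 0                                      ≡⟨ trans (+-identityʳ _) (+-identityʳ _) ⟩
  y C suc g                                                ∎)
vandermonde (suc x) y (suc g) = begin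
  suc (x + y) C suc g
    ≡⟨ sym (nCk+nC[k+1]≡[n+1]C[k+1] (x + y) g) ⟩
  (x + y) C g + (x + y) C suc g
    ≡⟨ cong₂ _+_ (vandermonde x y g) (vandermonde x y (suc g)) ⟩
  S + ∑ (antidiagonal (suc g)) (λ (i , j) → (x C i) * (y C j))
    ≡⟨ cong (S +_) (∑-antidiagonal-suc g (λ (i , j) → (x C i) * (y C j))) ⟩
  S + (1 * (y C suc g) + S′)
    ≡⟨ +-left-comm S _ S′ ⟩
  1 * (y C suc g) + (S + S′)
    ≡⟨ cong (1 * (y C suc g) +_) (sym (∑-distrib-+ (antidiagonal g) _ _)) ⟩
  1 * (y C suc g) + ∑ (antidiagonal g) (λ (i , j) → (x C i) * (y C j) + (x C suc i) * (y C j))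
    ≡⟨ cong (1 * (y C suc g) +_) (∑-cong (antidiagonal g) λ (i , j) →
         trans (sym (*-distribʳ-+ (y C j) (x C i) (x C suc i))) (cong (_* (y C j)) (nCk+nC[k+1]≡[n+1]C[k+1] x i))) ⟩
  1 * (y C suc g) + ∑ (antidiagonal g) (λ (i , j) → (suc x C suc i) * (y C j))
    ≡⟨ sym (∑-antidiagonal-suc g (λ (i , j) → (suc x C i) * (y C j))) ⟩
  ∑ (antidiagonal (suc g)) (λ (i , j) → (suc x C i) * (y C j)) ∎
  where
  S S′ : ℕ
  S  = ∑ (antidiagonal g) (λ (i , j) → (x C i) * (y C j))
  S′ = ∑ (antidiagonal g) (λ (i , j) → (x C suc i) * (y C j))

-- (i , j) ∷ m stands for the product of (xᵢ C j) and m
Monomial : Set → Set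
Monomial I = List (I × ℕ)

module _ {I : Set} where

  ∏C : Monomial I → (I → ℕ) → ℕ
  ∏C []            h = 1
  ∏C ((i , j) ∷ m) h = (h i C j) * ∏C m h

  ∏C-cong : ∀ (m : Monomial I) {h h′} → (∀ i → h i ≡ h′ i) → ∏C m h ≡ ∏C m h′
  ∏C-cong []            e = refl
  ∏C-cong ((i , j) ∷ m) e = cong₂ (λ x y → (x C j) * y) (e i) (∏C-cong m e)

  ∏C-++ : ∀ (m m′ : Monomial I) h → ∏C (m ++ m′) h ≡ ∏C m h * ∏C m′ h
  ∏C-++ []            m′ h = sym (+-identityʳ _)
  ∏C-++ ((i , j) ∷ m) m′ h = trans (cong ((h i C j) *_) (∏C-++ m m′ h)) (sym (*-assoc (h i C j) _ _))

  degree : Monomial I → ℕ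
  degree m = ∑ m proj₂

  -- Factors with exponent 0 are dropped (x C 0 = 1); this bounds the length of a monomial by its degree.
  Reduced : ℕ → Monomial I → Set
  Reduced g m = All (λ (_ , j) → 0 < j) m × degree m ≡ g

  Reduced-++ : ∀ {g g′} {m m′ : Monomial I} → Reduced g m → Reduced g′ m′ → Reduced (g + g′) (m ++ m′)
  Reduced-++ {m = m} {m′} (m>0 , refl) (m′>0 , refl) = All.++⁺ m>0 m′>0 , ∑-++ m m′ proj₂

  infixr 5 _∷₊_
  _∷₊_ : I × ℕ → Monomial I → Monomial I
  (i , zero)  ∷₊ m = m
  (i , suc j) ∷₊ m = (i , suc j) ∷ m

  ∏C-∷₊ : ∀ i j m h → ∏C ((i , j) ∷₊ m) h ≡ (h i C j) * ∏C m h
  ∏C-∷₊ i zero    m h = sym (+-identityʳ _)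
  ∏C-∷₊ i (suc j) m h = refl

  Reduced-∷₊ : ∀ i j {g m} → Reduced g m → Reduced (j + g) ((i , j) ∷₊ m)
  Reduced-∷₊ i zero    r               = r
  Reduced-∷₊ i (suc j) (m>0 , refl)    = s≤s z≤n ∷ m>0 , refl

  expandC : List I → ℕ → List (Monomial I)
  expandC []       zero    = [] ∷ []
  expandC []       (suc g) = []
  expandC (i ∷ is) g       = concatMap (λ (j , g′) → map ((i , j) ∷₊_) (expandC is g′)) (antidiagonal g)

  C-∑ : ∀ is g (h : I → ℕ) → (∑ is h) C g ≡ ∑[ m ∈ expandC is g ] ∏C m h
  C-∑ []       zero    h = refl
  C-∑ []       (suc g) h = refl
  C-∑ (i ∷ is) g       h = begin
    (h i + ∑ is h) C g
      ≡⟨ vandermonde (h i) (∑ is h) g ⟩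
    ∑ (antidiagonal g) (λ (j , g′) → (h i C j) * (∑ is h C g′))
      ≡⟨ ∑-cong (antidiagonal g) (λ (j , g′) → begin
           (h i C j) * (∑ is h C g′)                          ≡⟨ cong ((h i C j) *_) (C-∑ is g′ h) ⟩
           (h i C j) * ∑[ m ∈ expandC is g′ ] ∏C m h          ≡⟨ *-distribˡ-∑ (h i C j) (expandC is g′) _ ⟩
           ∑[ m ∈ expandC is g′ ] ((h i C j) * ∏C m h)        ≡⟨ ∑-cong (expandC is g′) (λ m → sym (∏C-∷₊ i j m h)) ⟩
           ∑[ m ∈ expandC is g′ ] ∏C ((i , j) ∷₊ m) h         ≡⟨ sym (∑-map ((i , j) ∷₊_) (expandC is g′) _) ⟩
           ∑[ m ∈ map ((i , j) ∷₊_) (expandC is g′) ] ∏C m h  ∎) ⟩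
    ∑ (antidiagonal g) (λ (j , g′) → ∑[ m ∈ map ((i , j) ∷₊_) (expandC is g′) ] ∏C m h)
      ≡⟨ sym (∑-concatMap _ (antidiagonal g) _) ⟩
    ∑[ m ∈ expandC (i ∷ is) g ] ∏C m h ∎

  expandC-reduced : ∀ is g → All (Reduced g) (expandC is g)
  expandC-reduced []       zero    = ([] , refl) ∷ []
  expandC-reduced []       (suc g) = []
  expandC-reduced (i ∷ is) g       = All.concat⁺ (All.map⁺ (All.map
    (λ {(j , g′)} j+g′≡g → All.map⁺ (All.map (λ r → subst (λ d → Reduced d _) j+g′≡g (Reduced-∷₊ i j r))
                                          (expandC-reduced is g′)))
    (antidiagonal-sum g)))

  substitute : (I → List I) → Monomial I → List (Monomial I)
  substitute σ []            = [] ∷ []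
  substitute σ ((i , j) ∷ m) = concatMap (λ m₁ → map (m₁ ++_) (substitute σ m)) (expandC (σ i) j)

  ∏C-substitute : ∀ σ m (h : I → ℕ) → ∏C m (λ i → ∑ (σ i) h) ≡ ∑[ m′ ∈ substitute σ m ] ∏C m′ h
  ∏C-substitute σ []            h = refl
  ∏C-substitute σ ((i , j) ∷ m) h = begin
    (∑ (σ i) h C j) * ∏C m (λ i → ∑ (σ i) h)
      ≡⟨ cong₂ _*_ (C-∑ (σ i) j h) (∏C-substitute σ m h) ⟩
    ∑[ m₁ ∈ expandC (σ i) j ] ∏C m₁ h * ∑[ m₂ ∈ substitute σ m ] ∏C m₂ h
      ≡⟨ ∑*∑ (expandC (σ i) j) (substitute σ m) _ _ ⟩
    ∑[ m₁ ∈ expandC (σ i) j ] ∑[ m₂ ∈ substitute σ m ] (∏C m₁ h * ∏C m₂ h)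
      ≡⟨ ∑-cong (expandC (σ i) j) (λ m₁ → trans (∑-cong (substitute σ m) (λ m₂ → sym (∏C-++ m₁ m₂ h)))
                                                (sym (∑-map (m₁ ++_) (substitute σ m) _))) ⟩
    ∑[ m₁ ∈ expandC (σ i) j ] ∑[ m′ ∈ map (m₁ ++_) (substitute σ m) ] ∏C m′ h
      ≡⟨ sym (∑-concatMap _ (expandC (σ i) j) _) ⟩
    ∑[ m′ ∈ substitute σ ((i , j) ∷ m) ] ∏C m′ h ∎

  substitute-reduced : ∀ σ (m : Monomial I) → All (Reduced (degree m)) (substitute σ m)
  substitute-reduced σ []            = ([] , refl) ∷ []
  substitute-reduced σ ((i , j) ∷ m) = All.concat⁺ (All.map⁺ (All.map
    (λ r₁ → All.map⁺ (All.map (Reduced-++ r₁) (substitute-reduced σ m)))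
    (expandC-reduced (σ i) j)))

module MonomialEnumeration {I : Set} (_≟_ : DecidableEquality I) (is : List I) (is-complete : ∀ i → i ∈ is) where

  -- the fuel f bounds the number of factors
  monomials : ℕ → ℕ → List (Monomial I)
  monomials _       zero    = [] ∷ []
  monomials zero    (suc g) = []
  monomials (suc f) (suc g) =
    concatMap (λ (j , g′) → concatMap (λ i → map ((i , suc j) ∷_) (monomials f g′)) is) (antidiagonal g)

  monomials-reduced : ∀ f g → All (Reduced g) (monomials f g)
  monomials-reduced _       zero    = ([] , refl) ∷ []
  monomials-reduced zero    (suc g) = []
  monomials-reduced (suc f) (suc g) = All.concat⁺ (All.map⁺ (All.map
    (λ {(j , g′)} j+g′≡g → All.concat⁺ (All.map⁺ (All.tabulate {xs = is} λ {i} _ →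
       All.map⁺ {f = (i , suc j) ∷_} (All.map (λ { (m>0 , refl) → s≤s z≤n ∷ m>0 , cong suc j+g′≡g })
                                            (monomials-reduced f g′)))))
    (antidiagonal-sum g)))

  monomials-complete : ∀ f {m} → All (λ (_ , j) → 0 < j) m → degree m ≤ f → m ∈ monomials f (degree m)
  monomials-complete f       []                          _ = here refl
  monomials-complete (suc f) {(i , suc j) ∷ m} (_ ∷ m>0) (s≤s d≤f) =
    ∈-concatMap⁺′ (∈-concatMap⁺′ (∈-map⁺ ((i , suc j) ∷_) (monomials-complete f m>0 (≤-trans (m≤n+m _ j) d≤f)))
                                  (is-complete i))
                  (antidiagonal-complete j (degree m))

  reducedMonomials : ℕ → List (Monomial I)
  reducedMonomials g = deduplicate (≡-dec (×-≡-dec _≟_ ℕ._≟_)) (monomials g g)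

  reducedMonomials-unique : ∀ g → Unique (reducedMonomials g)
  reducedMonomials-unique g = deduplicate-! (≡-dec (×-≡-dec _≟_ ℕ._≟_)) (monomials g g)

  ∈-reducedMonomials⁺ : ∀ g {m} → Reduced g m → m ∈ reducedMonomials g
  ∈-reducedMonomials⁺ _ (m>0 , refl) = ∈-deduplicate⁺ _ (monomials-complete _ m>0 ≤-refl)

  ∈-reducedMonomials⁻ : ∀ g {m} → m ∈ reducedMonomials g → Reduced g m
  ∈-reducedMonomials⁻ g m∈ = lookupᴬ (monomials-reduced g g) (∈-deduplicate⁻ _ (monomials g g) m∈)

#FA-C : ∀ {k} {f : List (Fin k) → ℕ} → InSharpFA f → ∀ g → InSharpFA (λ w → f w C g)
#FA-C {k} {f} (M , ⟦M⟧≗f) g = #FA-ext f≗ (#FA-span (expandC initial g) start⊆)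
  where
  open NFA M
  open MonomialEnumeration Fin._≟_ (allFin states) (∈-tabulate⁺ {f = id})

  Q : List (Fin states)
  Q = allFin states

  initial : List (Fin states)
  initial = multiset inw Q

  row : Fin k → Fin states → List (Fin states)
  row a q = multiset (wt q a) Q

  val : Monomial (Fin states) → List (Fin k) → ℕ
  val m w = ∏C m (λ q → run (fromNFA M) q w)

  expand-closed : ∀ a {m} → m ∈ reducedMonomials g → All (_∈ reducedMonomials g) (substitute (row a) m)
  expand-closed a {m} m∈ = All.map (∈-reducedMonomials⁺ g)
    (subst (λ d → All (Reduced d) (substitute (row a) m)) (proj₂ (∈-reducedMonomials⁻ g m∈)) (substitute-reduced (row a) m))

  val-∷ : ∀ a {m} w → m ∈ reducedMonomials g → val m (a ∷ w) ≡ ∑[ m′ ∈ substitute (row a) m ] val m′ w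
  val-∷ a {m} w _ = trans (∏C-cong m (λ q → sym (∑-multiset (wt q a) Q (λ t → run (fromNFA M) t w))))
                          (∏C-substitute (row a) m (λ t → run (fromNFA M) t w))

  open ClosedFamily (≡-dec (×-≡-dec Fin._≟_ ℕ._≟_)) (reducedMonomials g) (reducedMonomials-unique g)
                    val (λ a → substitute (row a)) expand-closed val-∷

  start⊆ : All (_∈ reducedMonomials g) (expandC initial g)
  start⊆ = All.map (∈-reducedMonomials⁺ g) (expandC-reduced initial g)

  f≗ : ∀ w → ∑[ m ∈ expandC initial g ] val m w ≡ f w C g
  f≗ w = begin
    ∑[ m ∈ expandC initial g ] val m w         ≡⟨ sym (C-∑ initial g (λ q → run (fromNFA M) q w)) ⟩
    ∑ initial (λ q → run (fromNFA M) q w) C g  ≡⟨ cong (_C g) (∑-multiset inw Q _) ⟩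
    eval (fromNFA M) w C g                     ≡⟨ cong (_C g) (trans (eval-fromNFA M w) (⟦M⟧≗f w)) ⟩
    f w C g                                    ∎

-- State counts truncated at a threshold

module Threshold (N : ℕ) where

  Split : ℕ → ℕ → Set
  Split a b = b ≡ 0 ⊎ N ≤ a

  Split-⊓-∸ : ∀ x → Split (N ⊓ x) (x ∸ N)
  Split-⊓-∸ x with x ≤? N
  ... | yes x≤N = inj₁ (m≤n⇒m∸n≡0 x≤N)
  ... | no  x≰N = inj₂ (≤-reflexive (sym (m≤n⇒m⊓n≡m (≰⇒≥ x≰N))))

  Split-+ : ∀ {a b c d} → Split a b → Split c d → Split (a + c) (b + d)
  Split-+ (inj₁ refl) (inj₁ refl)   = inj₁ refl
  Split-+ {a} (inj₁ _) (inj₂ N≤c)   = inj₂ (≤-trans N≤c (m≤n+m _ a))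
  Split-+ {c = c} (inj₂ N≤a) _      = inj₂ (≤-trans N≤a (m≤m+n _ c))

  Split-* : ∀ c {a b} → Split a b → Split (c * a) (c * b)
  Split-* zero    _           = inj₁ refl
  Split-* (suc c) (inj₁ refl) = inj₁ (*-zeroʳ (suc c))
  Split-* (suc c) (inj₂ N≤a)  = inj₂ (≤-trans N≤a (m≤m+n _ (c * _)))

  Split-∑ : ∀ (xs : List A) (c x : A → ℕ) → Split (∑[ t ∈ xs ] (c t * (N ⊓ x t))) (∑[ t ∈ xs ] (c t * (x t ∸ N)))
  Split-∑ []       c x = inj₁ refl
  Split-∑ (t ∷ xs) c x = Split-+ (Split-* (c t) (Split-⊓-∸ (x t))) (Split-∑ xs c x)

  ∸-Split : ∀ {a b} → Split a b → (a + b) ∸ N ≡ (a ∸ N) + b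
  ∸-Split {a} (inj₁ refl) = trans (cong (_∸ N) (+-identityʳ a)) (sym (+-identityʳ _))
  ∸-Split {a} {b} (inj₂ N≤a) = +-∸-comm b N≤a

  ⊓-Split : ∀ {a b} → Split a b → N ⊓ (a + b) ≡ N ⊓ a
  ⊓-Split {a} (inj₁ refl)    = cong (N ⊓_) (+-identityʳ a)
  ⊓-Split {a} {b} (inj₂ N≤a) = trans (m≤n⇒m⊓n≡m (≤-trans N≤a (m≤m+n a b))) (sym (m≤n⇒m⊓n≡m N≤a))

  ∑-⊓+∸ : ∀ (xs : List A) (c x : A → ℕ) →
          ∑[ t ∈ xs ] (c t * x t) ≡ ∑[ t ∈ xs ] (c t * (N ⊓ x t)) + ∑[ t ∈ xs ] (c t * (x t ∸ N))
  ∑-⊓+∸ xs c x = trans (∑-cong xs (λ t → trans (cong (c t *_) (sym (m⊓n+n∸m≡n N (x t))))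
                                                (*-distribˡ-+ (c t) _ _)))
                       (∑-distrib-+ xs _ _)

  ⊓-∑ : ∀ (xs : List A) (c x : A → ℕ) → N ⊓ ∑[ t ∈ xs ] (c t * x t) ≡ N ⊓ ∑[ t ∈ xs ] (c t * (N ⊓ x t))
  ⊓-∑ xs c x = trans (cong (N ⊓_) (∑-⊓+∸ xs c x)) (⊓-Split (Split-∑ xs c x))

  ∸-∑ : ∀ (xs : List A) (c x : A → ℕ) →
        ∑[ t ∈ xs ] (c t * x t) ∸ N ≡ (∑[ t ∈ xs ] (c t * (N ⊓ x t)) ∸ N) + ∑[ t ∈ xs ] (c t * (x t ∸ N))
  ∸-∑ xs c x = trans (cong (_∸ N) (∑-⊓+∸ xs c x)) (∸-Split (Split-∑ xs c x))

vectors : List A → (n : ℕ) → List (Vec A n)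
vectors xs zero    = Vec.[] ∷ []
vectors xs (suc n) = cartesianProductWith Vec._∷_ xs (vectors xs n)

∈-vectors : ∀ {xs : List A} {n} (v : Vec A n) → (∀ i → Vec.lookup v i ∈ xs) → v ∈ vectors xs n
∈-vectors Vec.[]       _   = here refl
∈-vectors (x Vec.∷ v) v∈ = ∈-cartesianProductWith⁺ Vec._∷_ (v∈ Fin.zero) (∈-vectors v (v∈ ∘ Fin.suc))

module Profiles {k} (M : NFA k) (N : ℕ) where
  open NFA M
  open Threshold N

  Q : List (Fin states)
  Q = allFin states

  count : Fin states → List (Fin k) → ℕ
  count q w = run (fromNFA M) q w

  Profile : Set
  Profile = Vec ℕ states

  profile : List (Fin k) → Profile
  profile w = Vec.tabulate (λ q → N ⊓ count q w)

  step : Fin k → Profile → Profile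
  step a σ = Vec.tabulate (λ q → N ⊓ ∑[ t ∈ Q ] (wt q a t * Vec.lookup σ t))

  profile-∷ : ∀ a w → profile (a ∷ w) ≡ step a (profile w)
  profile-∷ a w = Vec.tabulate-cong λ q → trans (⊓-∑ Q (wt q a) (λ t → count t w))
    (cong (N ⊓_) (∑-cong Q (λ t → cong (wt q a t *_) (sym (Vec.lookup∘tabulate (λ q → N ⊓ count q w) t)))))

  _≟ᵖ_ : DecidableEquality Profile
  _≟ᵖ_ = Vec.≡-dec ℕ._≟_

  profiles : List Profile
  profiles = deduplicate _≟ᵖ_ (vectors (upTo (suc N)) states)

  profiles-unique : Unique profiles
  profiles-unique = deduplicate-! _≟ᵖ_ (vectors (upTo (suc N)) states)

  profile∈profiles : ∀ w → profile w ∈ profiles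
  profile∈profiles w = ∈-deduplicate⁺ _≟ᵖ_ (∈-vectors (profile w) λ q →
    subst (_∈ upTo (suc N)) (sym (Vec.lookup∘tabulate (λ q → N ⊓ count q w) q))
          (∈-applyUpTo⁺ id (s≤s (m⊓n≤m N (count q w)))))

  Excess : Set
  Excess = Maybe (Fin states)

  excesses : List Excess
  excesses = nothing ∷ map just Q

  excess : Excess → List (Fin k) → ℕ
  excess nothing  w = 1
  excess (just q) w = count q w ∸ N

  ∑-excesses : ∀ h → ∑ excesses h ≡ h nothing + ∑[ q ∈ Q ] h (just q)
  ∑-excesses h = cong (h nothing +_) (∑-map just Q h)

  -- The excesses after a letter are ℕ-linear in the excesses before, with coefficients that depend only on
  -- the profile (by ∸-∑).
  excess-wt : Excess → Fin k → Profile → Excess → ℕ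
  excess-wt nothing  a σ nothing  = 1
  excess-wt nothing  a σ (just t) = 0
  excess-wt (just q) a σ nothing  = ∑[ t ∈ Q ] (wt q a t * Vec.lookup σ t) ∸ N
  excess-wt (just q) a σ (just t) = wt q a t

  excess-∷ : ∀ x a w → excess x (a ∷ w) ≡ ∑[ y ∈ excesses ] (excess-wt x a (profile w) y * excess y w)
  excess-∷ nothing a w = cong (1 +_) (sym (trans (∑-map just Q _) (∑-zero Q)))
  excess-∷ (just q) a w = begin
    ∑[ t ∈ Q ] (wt q a t * count t w) ∸ N
      ≡⟨ ∸-∑ Q (wt q a) (λ t → count t w) ⟩
    (∑[ t ∈ Q ] (wt q a t * (N ⊓ count t w)) ∸ N) + ∑[ t ∈ Q ] (wt q a t * (count t w ∸ N))
      ≡⟨ cong (_+ ∑[ t ∈ Q ] (wt q a t * (count t w ∸ N)))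
              (trans (cong (_∸ N) (∑-cong Q λ t → cong (wt q a t *_) (sym (Vec.lookup∘tabulate (λ q → N ⊓ count q w) t))))
                     (sym (*-identityʳ _))) ⟩
    excess-wt (just q) a (profile w) nothing * 1 + ∑[ t ∈ Q ] (wt q a t * (count t w ∸ N))
      ≡⟨ sym (∑-excesses (λ y → excess-wt (just q) a (profile w) y * excess y w)) ⟩
    ∑[ y ∈ excesses ] (excess-wt (just q) a (profile w) y * excess y w) ∎

  Label : Set
  Label = Profile × Excess

  labels : List Label
  labels = cartesianProduct profiles excesses

  tracked : Label → List (Fin k) → ℕ
  tracked (σ , x) w = 𝟙 (σ ≟ᵖ profile w) * excess x w

  ∑-tracked : ∀ w (F : Label → ℕ) →
              ∑[ ℓ ∈ labels ] (F ℓ * tracked ℓ w) ≡ ∑[ y ∈ excesses ] (F (profile w , y) * excess y w)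
  ∑-tracked w F = begin
    ∑[ ℓ ∈ labels ] (F ℓ * tracked ℓ w)
      ≡⟨ ∑-cartesianProduct profiles excesses _ ⟩
    ∑[ σ ∈ profiles ] ∑[ y ∈ excesses ] (F (σ , y) * (𝟙 (σ ≟ᵖ profile w) * excess y w))
      ≡⟨ ∑-cong profiles (λ σ →
           trans (∑-cong excesses (λ y → *-left-comm (F (σ , y)) (𝟙 (σ ≟ᵖ profile w)) (excess y w)))
                 (sym (*-distribˡ-∑ (𝟙 (σ ≟ᵖ profile w)) excesses (λ y → F (σ , y) * excess y w)))) ⟩
    ∑[ σ ∈ profiles ] (𝟙 (σ ≟ᵖ profile w) * ∑[ y ∈ excesses ] (F (σ , y) * excess y w))
      ≡⟨ ∑-𝟙 _≟ᵖ_ (λ σ → ∑[ y ∈ excesses ] (F (σ , y) * excess y w)) profiles-unique (profile∈profiles w) ⟩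
    ∑[ y ∈ excesses ] (F (profile w , y) * excess y w) ∎

  -- a state (σ , x) guesses that the rest of the input has profile σ
  tracker : (Label → ℕ) → Automaton k
  tracker I = record
    { State  = Label
    ; states = labels
    ; wt     = λ (σ , x) a (σ′ , y) → 𝟙 (σ ≟ᵖ step a σ′) * excess-wt x a σ′ y
    ; inw    = I
    ; outw   = λ ℓ → tracked ℓ []
    }

  tracked-∷ : ∀ I {ℓ} a w → ℓ ∈ labels →
              tracked ℓ (a ∷ w) ≡ ∑[ ℓ′ ∈ labels ] (Automaton.wt (tracker I) ℓ a ℓ′ * tracked ℓ′ w)
  tracked-∷ I {σ , x} a w _ = begin
    𝟙 (σ ≟ᵖ profile (a ∷ w)) * excess x (a ∷ w)
      ≡⟨ cong₂ (λ τ e → 𝟙 (σ ≟ᵖ τ) * e) (profile-∷ a w) (excess-∷ x a w) ⟩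
    𝟙 (σ ≟ᵖ step a (profile w)) * ∑[ y ∈ excesses ] (excess-wt x a (profile w) y * excess y w)
      ≡⟨ *-distribˡ-∑ (𝟙 (σ ≟ᵖ step a (profile w))) excesses _ ⟩
    ∑[ y ∈ excesses ] (𝟙 (σ ≟ᵖ step a (profile w)) * (excess-wt x a (profile w) y * excess y w))
      ≡⟨ ∑-cong excesses (λ y → sym (*-assoc (𝟙 (σ ≟ᵖ step a (profile w))) _ _)) ⟩
    ∑[ y ∈ excesses ] (𝟙 (σ ≟ᵖ step a (profile w)) * excess-wt x a (profile w) y * excess y w)
      ≡⟨ sym (∑-tracked w (λ (σ′ , y) → 𝟙 (σ ≟ᵖ step a σ′) * excess-wt x a σ′ y)) ⟩
    ∑[ ℓ′ ∈ labels ] (Automaton.wt (tracker I) (σ , x) a ℓ′ * tracked ℓ′ w) ∎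

  #FA-tracked : ∀ (I : Label → ℕ) → InSharpFA (λ w → ∑[ y ∈ excesses ] (I (profile w , y) * excess y w))
  #FA-tracked I = #FA-ext (λ w → trans (Automaton.eval-unique (tracker I) tracked (λ _ → refl) (tracked-∷ I) w)
                                       (∑-tracked w I))
                          (eval-#FA (tracker I))

  #FA-profile≡ : ∀ σ → InSharpFA (λ w → 𝟙 (σ ≟ᵖ profile w))
  #FA-profile≡ σ = #FA-ext (λ w → trans (∑-excesses _)
                                  (trans (cong₂ _+_ (*-identityʳ _) (∑-zero Q)) (+-identityʳ _)))
                           (#FA-tracked I)
    where
    I : Label → ℕ
    I (τ , nothing) = 𝟙 (σ ≟ᵖ τ)
    I (τ , just _)  = 0

  low : Profile → ℕ
  low σ = ∑[ q ∈ Q ] (inw q * Vec.lookup σ q)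

  high : List (Fin k) → ℕ
  high w = ∑[ q ∈ Q ] (inw q * (count q w ∸ N))

  #FA-high : InSharpFA high
  #FA-high = #FA-ext (λ w → ∑-excesses (λ y → I (profile w , y) * excess y w)) (#FA-tracked I)
    where
    I : Label → ℕ
    I (_ , nothing) = 0
    I (_ , just q)  = inw q

  low-profile : ∀ w → low (profile w) ≡ ∑[ q ∈ Q ] (inw q * (N ⊓ count q w))
  low-profile w = ∑-cong Q (λ q → cong (inw q *_) (Vec.lookup∘tabulate (λ q → N ⊓ count q w) q))

  ⟦M⟧≡low+high : ∀ w → ⟦ M ⟧ w ≡ low (profile w) + high w
  ⟦M⟧≡low+high w = begin
    ⟦ M ⟧ w                                               ≡⟨ sym (eval-fromNFA M w) ⟩
    ∑[ q ∈ Q ] (inw q * count q w)                        ≡⟨ ∑-⊓+∸ Q inw (λ q → count q w) ⟩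
    ∑[ q ∈ Q ] (inw q * (N ⊓ count q w)) + high w         ≡⟨ cong (_+ high w) (sym (low-profile w)) ⟩
    low (profile w) + high w                              ∎

  Split-low-high : ∀ w → Split (low (profile w)) (high w)
  Split-low-high w = subst (λ a → Split a (high w)) (sym (low-profile w)) (Split-∑ Q inw (λ q → count q w))

-- Composition with an eventual Newton series

newtonFrom : ℕ → List ℕ → ℕ → ℕ
newtonFrom i []      x = 0
newtonFrom i (c ∷ a) x = c * (x C i) + newtonFrom (suc i) a x

newton : List ℕ → ℕ → ℕ
newton = newtonFrom 0

newtonFrom-0 : ∀ i a → newtonFrom (suc i) a 0 ≡ 0
newtonFrom-0 i []      = refl
newtonFrom-0 i (c ∷ a) = cong₂ _+_ (*-zeroʳ c) (newtonFrom-0 (suc i) a)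

newtonFrom-suc : ∀ i a x → newtonFrom (suc i) a (suc x) ≡ newtonFrom (suc i) a x + newtonFrom i a x
newtonFrom-suc i []      x = refl
newtonFrom-suc i (c ∷ a) x = begin
  c * (suc x C suc i) + newtonFrom (2 + i) a (suc x)
    ≡⟨ cong₂ (λ b r → c * b + r) (sym (nCk+nC[k+1]≡[n+1]C[k+1] x i)) (newtonFrom-suc (suc i) a x) ⟩
  c * ((x C i) + (x C suc i)) + (newtonFrom (2 + i) a x + newtonFrom (suc i) a x)
    ≡⟨ rearrange c (x C i) (x C suc i) _ _ ⟩
  (c * (x C suc i) + newtonFrom (2 + i) a x) + (c * (x C i) + newtonFrom (suc i) a x) ∎
  where
  rearrange : ∀ c b b′ r r′ → c * (b + b′) + (r + r′) ≡ (c * b′ + r) + (c * b + r′)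
  rearrange = solve-∀

newton-suc : ∀ c a x → newton (c ∷ a) (suc x) ≡ newton (c ∷ a) x + newton a x
newton-suc c a x = trans (cong (c * 1 +_) (newtonFrom-suc 0 a x)) (sym (+-assoc (c * 1) _ _))

#FA-newtonFrom : ∀ {k} {g : List (Fin k) → ℕ} → InSharpFA g →
                 ∀ K i a → InSharpFA (λ w → newtonFrom i a (K + g w))
#FA-newtonFrom g∈ K i []      = #FA-const 0
#FA-newtonFrom g∈ K i (c ∷ a) =
  #FA-+ (#FA-scale c (#FA-ext (λ w → sym (vandermonde K _ i))
                              (#FA-∑ (antidiagonal i) (λ (j , l) → #FA-scale (K C j) (#FA-C g∈ l)))))
        (#FA-newtonFrom g∈ K (suc i) a)

#FA-∘ : ∀ {k} {f : List (Fin k) → ℕ} (p : ℕ → ℕ) N a → (∀ x → p (N + x) ≡ newton a x) →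
        InSharpFA f → InSharpFA (λ w → p (f w))
#FA-∘ {f = f} p N a p≡newton (M , ⟦M⟧≗f) = #FA-ext p∘f≡ (#FA-∑ profiles slice)
  where
  open Profiles M N
  open Threshold N

  slice : ∀ σ → InSharpFA (λ w → 𝟙 (σ ≟ᵖ profile w) * p (low σ + high w))
  slice σ with N ≤? low σ
  ... | yes N≤low =
    #FA-* (#FA-profile≡ σ) (#FA-ext (λ w → sym (p≡ w)) (#FA-newtonFrom #FA-high (low σ ∸ N) 0 a))
    where
    p≡ : ∀ w → p (low σ + high w) ≡ newton a (low σ ∸ N + high w)
    p≡ w = trans (cong p (trans (cong (_+ high w) (sym (m+[n∸m]≡n N≤low))) (+-assoc N _ (high w))))
                 (p≡newton _)
  ... | no N≰low =
    #FA-ext (λ w → 𝟙-*-cong (σ ≟ᵖ profile w) (p≡ w)) (#FA-* (#FA-profile≡ σ) (#FA-const (p (low σ))))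
    where
    p≡ : ∀ w → σ ≡ profile w → p (low σ) ≡ p (low σ + high w)
    p≡ w refl with Split-low-high w
    ... | inj₁ high≡0 = cong p (sym (trans (cong (low σ +_) high≡0) (+-identityʳ _)))
    ... | inj₂ N≤low  = contradiction N≤low N≰low

  p∘f≡ : ∀ w → ∑[ σ ∈ profiles ] (𝟙 (σ ≟ᵖ profile w) * p (low σ + high w)) ≡ p (f w)
  p∘f≡ w = begin
    ∑[ σ ∈ profiles ] (𝟙 (σ ≟ᵖ profile w) * p (low σ + high w))
      ≡⟨ ∑-𝟙 _≟ᵖ_ (λ σ → p (low σ + high w)) profiles-unique (profile∈profiles w) ⟩
    p (low (profile w) + high w)   ≡⟨ cong p (sym (⟦M⟧≡low+high w)) ⟩
    p (⟦ M ⟧ w)                    ≡⟨ cong p (⟦M⟧≗f w) ⟩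
    p (f w)                        ∎

-- Finite differences of polynomials

module _ where
  open import Data.Rational using () renaming (_+_ to _+ℚ_; _*_ to _*ℚ_; _-_ to _-ℚ_)
  open import Data.Rational.Solver using (module +-*-Solver)
  open +-*-Solver

  Δ : (ℚ → ℚ) → ℚ → ℚ
  Δ H x = H (x +ℚ 1ℚ) -ℚ H x

  Δ^ : ℕ → (ℚ → ℚ) → ℚ → ℚ
  Δ^ zero    H = H
  Δ^ (suc n) H = Δ^ n (Δ H)

  Δ^-cong : ∀ n {H G} → (∀ x → H x ≡ G x) → ∀ x → Δ^ n H x ≡ Δ^ n G x
  Δ^-cong zero    H≗G = H≗G
  Δ^-cong (suc n) H≗G = Δ^-cong n (λ x → cong₂ _-ℚ_ (H≗G (x +ℚ 1ℚ)) (H≗G x))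

  Δ^-+ : ∀ n H G x → Δ^ n (λ x → H x +ℚ G x) x ≡ Δ^ n H x +ℚ Δ^ n G x
  Δ^-+ zero    H G x = refl
  Δ^-+ (suc n) H G x = trans (Δ^-cong n Δ-+ x) (Δ^-+ n (Δ H) (Δ G) x)
    where
    Δ-+ : ∀ x → Δ (λ x → H x +ℚ G x) x ≡ Δ H x +ℚ Δ G x
    Δ-+ x = solve 4 (λ a b c d → (a :+ b) :- (c :+ d) := (a :- c) :+ (b :- d)) refl
                    (H (x +ℚ 1ℚ)) (G (x +ℚ 1ℚ)) (H x) (G x)

  Δ^-shift : ∀ n H x → Δ^ n (λ x → H (x +ℚ 1ℚ)) x ≡ Δ^ n H (x +ℚ 1ℚ)
  Δ^-shift zero    H x = refl
  Δ^-shift (suc n) H x = Δ^-shift n (Δ H) x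

  Δ^-0 : ∀ n x → Δ^ n (λ _ → 0ℚ) x ≡ 0ℚ
  Δ^-0 zero    x = refl
  Δ^-0 (suc n) x = Δ^-0 n x

  Δ^-const : ∀ n c x → Δ^ (suc n) (λ _ → c) x ≡ 0ℚ
  Δ^-const n c x = trans (Δ^-cong n (λ _ → solve 1 (λ c → c :- c := con 0ℚ) refl c) x) (Δ^-0 n x)

  -- Δ (x H) = H(x + 1) + x ΔH, so multiplying by x raises the order of vanishing by one.
  Δ^-* : ∀ n H → (∀ x → Δ^ n H x ≡ 0ℚ) → ∀ x → Δ^ (suc n) (λ x → x *ℚ H x) x ≡ 0ℚ
  Δ^-* zero    H ΔⁿH≡0 x = begin
    (x +ℚ 1ℚ) *ℚ H (x +ℚ 1ℚ) -ℚ x *ℚ H x  ≡⟨ cong₂ (λ a b → (x +ℚ 1ℚ) *ℚ a -ℚ x *ℚ b) (ΔⁿH≡0 (x +ℚ 1ℚ)) (ΔⁿH≡0 x) ⟩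
    (x +ℚ 1ℚ) *ℚ 0ℚ -ℚ x *ℚ 0ℚ           ≡⟨ solve 1 (λ x → (x :+ con 1ℚ) :* con 0ℚ :- x :* con 0ℚ := con 0ℚ) refl x ⟩
    0ℚ                               ∎
  Δ^-* (suc n) H ΔⁿH≡0 x = begin
    Δ^ (suc n) (Δ (λ x → x *ℚ H x)) x                                ≡⟨ Δ^-cong (suc n) Δ-* x ⟩
    Δ^ (suc n) (λ x → H (x +ℚ 1ℚ) +ℚ x *ℚ Δ H x) x                     ≡⟨ Δ^-+ (suc n) (λ x → H (x +ℚ 1ℚ)) (λ x → x *ℚ Δ H x) x ⟩
    Δ^ (suc n) (λ x → H (x +ℚ 1ℚ)) x +ℚ Δ^ (suc n) (λ x → x *ℚ Δ H x) x
      ≡⟨ cong₂ _+ℚ_ (trans (Δ^-shift (suc n) H x) (ΔⁿH≡0 (x +ℚ 1ℚ))) (Δ^-* n (Δ H) ΔⁿH≡0 x) ⟩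
    0ℚ +ℚ 0ℚ                                                         ≡⟨⟩
    0ℚ                                                              ∎
    where
    Δ-* : ∀ x → Δ (λ x → x *ℚ H x) x ≡ H (x +ℚ 1ℚ) +ℚ x *ℚ Δ H x
    Δ-* x = solve 3 (λ x h₁ h₀ → (x :+ con 1ℚ) :* h₁ :- x :* h₀ := h₁ :+ x :* (h₁ :- h₀)) refl x (H (x +ℚ 1ℚ)) (H x)

  Δ^-evalPoly : ∀ φ x → Δ^ (length φ) (evalPoly φ) x ≡ 0ℚ
  Δ^-evalPoly []      x = refl
  Δ^-evalPoly (c ∷ φ) x = begin
    Δ^ (suc (length φ)) (λ x → c +ℚ x *ℚ evalPoly φ x) x
      ≡⟨ Δ^-+ (suc (length φ)) (λ _ → c) (λ x → x *ℚ evalPoly φ x) x ⟩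
    Δ^ (suc (length φ)) (λ _ → c) x +ℚ Δ^ (suc (length φ)) (λ x → x *ℚ evalPoly φ x) x
      ≡⟨ cong₂ _+ℚ_ (Δ^-const (length φ) c x) (Δ^-* (length φ) (evalPoly φ) (Δ^-evalPoly φ) x) ⟩
    0ℚ ∎

module _ where
  open import Data.Rational using (toℚᵘ) renaming (_+_ to _+ℚ_; _-_ to _-ℚ_; -_ to -ℚ_)
  import Data.Rational.Properties as ℚ
  import Data.Rational.Unnormalised as ℚᵘ
  import Data.Rational.Unnormalised.Properties as ℚᵘ
  open import Data.Integer using (+_; -[1+_])

  toℚᵘ-ℤ→ℚ : ∀ z → toℚᵘ (ℤ→ℚ z) ℚᵘ.≃ ℚᵘ.mkℚᵘ z 0
  toℚᵘ-ℤ→ℚ z = ℚ.toℚᵘ-fromℚᵘ (ℚᵘ.mkℚᵘ z 0)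

  ℤ→ℚ-+ : ∀ a b → ℤ→ℚ (a ℤ.+ b) ≡ ℤ→ℚ a +ℚ ℤ→ℚ b
  ℤ→ℚ-+ a b = ℚ.toℚᵘ-injective (begin≃
    toℚᵘ (ℤ→ℚ (a ℤ.+ b))                 ≈⟨ toℚᵘ-ℤ→ℚ (a ℤ.+ b) ⟩
    ℚᵘ.mkℚᵘ (a ℤ.+ b) 0                   ≈⟨ ℚᵘ.*≡* (cong (ℤ._* + 1) (cong₂ ℤ._+_ (ℤ.*-identityʳ a) (ℤ.*-identityʳ b))) ⟨
    ℚᵘ.mkℚᵘ a 0 ℚᵘ.+ ℚᵘ.mkℚᵘ b 0          ≈⟨ ℚᵘ.+-cong (toℚᵘ-ℤ→ℚ a) (toℚᵘ-ℤ→ℚ b) ⟨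
    toℚᵘ (ℤ→ℚ a) ℚᵘ.+ toℚᵘ (ℤ→ℚ b)        ≈⟨ ℚ.toℚᵘ-homo-+ (ℤ→ℚ a) (ℤ→ℚ b) ⟨
    toℚᵘ (ℤ→ℚ a +ℚ ℤ→ℚ b)                ∎≃)
    where open ℚᵘ.≃-Reasoning using (step-≈-⟩; step-≈-⟨) renaming (begin_ to begin≃_; _∎ to _∎≃)

  ℤ→ℚ-neg : ∀ a → ℤ→ℚ (ℤ.- a) ≡ -ℚ ℤ→ℚ a
  ℤ→ℚ-neg a = ℚ.toℚᵘ-injective (begin≃
    toℚᵘ (ℤ→ℚ (ℤ.- a))   ≈⟨ toℚᵘ-ℤ→ℚ (ℤ.- a) ⟩
    ℚᵘ.mkℚᵘ (ℤ.- a) 0     ≈⟨ ℚᵘ.-‿cong (toℚᵘ-ℤ→ℚ a) ⟨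
    ℚᵘ.- toℚᵘ (ℤ→ℚ a)     ≈⟨ ℚ.toℚᵘ-homo‿- (ℤ→ℚ a) ⟨
    toℚᵘ (-ℚ ℤ→ℚ a)       ∎≃)
    where open ℚᵘ.≃-Reasoning using (step-≈-⟩; step-≈-⟨) renaming (begin_ to begin≃_; _∎ to _∎≃)

  ℤ→ℚ-- : ∀ a b → ℤ→ℚ (a ℤ.- b) ≡ ℤ→ℚ a -ℚ ℤ→ℚ b
  ℤ→ℚ-- a b = trans (ℤ→ℚ-+ a (ℤ.- b)) (cong (ℤ→ℚ a +ℚ_) (ℤ→ℚ-neg b))

  ℕ→ℚ-suc : ∀ n → ℕ→ℚ (suc n) ≡ ℕ→ℚ n +ℚ 1ℚ
  ℕ→ℚ-suc n = trans (cong ℕ→ℚ (+-comm 1 n)) (ℤ→ℚ-+ (+ n) (+ 1))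

  ℤ→ℚ-injective : ∀ {a b} → ℤ→ℚ a ≡ ℤ→ℚ b → a ≡ b
  ℤ→ℚ-injective {a} {b} eq
    with ℚᵘ.≃-trans (ℚᵘ.≃-sym (toℚᵘ-ℤ→ℚ a)) (ℚᵘ.≃-trans (ℚ.toℚᵘ-cong eq) (toℚᵘ-ℤ→ℚ b))
  ... | ℚᵘ.*≡* a*1≡b*1 = trans (sym (ℤ.*-identityʳ a)) (trans a*1≡b*1 (ℤ.*-identityʳ b))

  ⌊_⌋₊ : ℤ → ℕ
  ⌊ + n ⌋₊      = n
  ⌊ -[1+ n ] ⌋₊ = 0

  ℕ→ℚ-⌊⌋₊ : ∀ z → ℕ→ℚ ⌊ z ⌋₊ ≡ ℤ→ℚ z ⊔ 0ℚ
  ℕ→ℚ-⌊⌋₊ (+ n)      = sym (ℚ.p≥q⇒p⊔q≡p (ℚ.nonNegative⁻¹ (ℕ→ℚ n) {{ℚ.normalize-nonNeg n 1}}))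
  ℕ→ℚ-⌊⌋₊ -[1+ n ]   = sym (ℚ.p≤q⇒p⊔q≡q (ℚ.<⇒≤ (ℚ.negative⁻¹ (ℤ→ℚ -[1+ n ])
                              {{ℚ.neg-pos {Data.Rational.normalize (suc n) 1} (ℚ.normalize-pos (suc n) 1)}})))

module _ where
  open import Data.Integer.Tactic.RingSolver using () renaming (solve-∀ to solveℤ-∀)

  Δˢ : (ℕ → ℤ) → ℕ → ℤ
  Δˢ h n = h (suc n) ℤ.- h n

  Δˢ^ : ℕ → (ℕ → ℤ) → ℕ → ℤ
  Δˢ^ zero    h = h
  Δˢ^ (suc L) h = Δˢ^ L (Δˢ h)

  ℤ→ℚ-Δˢ^ : ∀ L h H → (∀ n → ℤ→ℚ (h n) ≡ H (ℕ→ℚ n)) → ∀ n → ℤ→ℚ (Δˢ^ L h n) ≡ Δ^ L H (ℕ→ℚ n)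
  ℤ→ℚ-Δˢ^ zero    h H h≗H = h≗H
  ℤ→ℚ-Δˢ^ (suc L) h H h≗H = ℤ→ℚ-Δˢ^ L (Δˢ h) (Δ H) λ n →
    trans (ℤ→ℚ-- (h (suc n)) (h n)) (cong₂ Data.Rational._-_ (trans (h≗H (suc n)) (cong H (ℕ→ℚ-suc n))) (h≗H n))

  -- newtonℤ a m = ∑ᵢ aᵢ (m C i), computed by Pascal's rule
  newtonℤ : List ℤ → ℕ → ℤ
  newtonℤ []      m       = 0ℤ
  newtonℤ (c ∷ a) zero    = c
  newtonℤ (c ∷ a) (suc m) = newtonℤ (c ∷ a) m ℤ.+ newtonℤ a m

  differences : ℕ → (ℕ → ℤ) → List ℤ
  differences zero    h = []
  differences (suc L) h = h 0 ∷ differences L (Δˢ h)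

  newton-forward : ∀ L h → (∀ n → Δˢ^ L h n ≡ 0ℤ) → ∀ m → h m ≡ newtonℤ (differences L h) m
  newton-forward zero    h Δᴸh≡0 m       = Δᴸh≡0 m
  newton-forward (suc L) h Δᴸh≡0 zero    = refl
  newton-forward (suc L) h Δᴸh≡0 (suc m) = trans (solve-∀′ (h (suc m)) (h m))
    (cong₂ ℤ._+_ (newton-forward (suc L) h Δᴸh≡0 m) (newton-forward L (Δˢ h) Δᴸh≡0 m))
    where
    solve-∀′ : ∀ b a → b ≡ a ℤ.+ (b ℤ.- a)
    solve-∀′ = solveℤ-∀

  head₀ : List ℤ → ℤ
  head₀ []      = 0ℤ
  head₀ (c ∷ _) = c

  shift : List ℤ → List ℤ
  shift []      = []
  shift (c ∷ a) = (c ℤ.+ head₀ a) ∷ shift a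

  newtonℤ-shift : ∀ a m → newtonℤ (shift a) m ≡ newtonℤ a (suc m)
  newtonℤ-shift []      m       = refl
  newtonℤ-shift (c ∷ a) zero    = cong (λ z → c ℤ.+ z) (head₀-newtonℤ a)
    where
    head₀-newtonℤ : ∀ a → head₀ a ≡ newtonℤ a 0
    head₀-newtonℤ []      = refl
    head₀-newtonℤ (c ∷ a) = refl
  newtonℤ-shift (c ∷ a) (suc m) = cong₂ ℤ._+_ (newtonℤ-shift (c ∷ a) m) (newtonℤ-shift a m)

  shift^ : ℕ → List ℤ → List ℤ
  shift^ zero    a = a
  shift^ (suc K) a = shift (shift^ K a)

  newtonℤ-shift^ : ∀ K a m → newtonℤ (shift^ K a) m ≡ newtonℤ a (K + m)
  newtonℤ-shift^ zero    a m = refl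
  newtonℤ-shift^ (suc K) a m =
    trans (newtonℤ-shift (shift^ K a) m) (trans (newtonℤ-shift^ K a (suc m)) (cong (newtonℤ a) (+-suc K m)))

  shift^-+ : ∀ t K a → shift^ t (shift^ K a) ≡ shift^ (t + K) a
  shift^-+ zero    K a = refl
  shift^-+ (suc t) K a = cong shift (shift^-+ t K a)

  shift^-∷ : ∀ K c a → ∃ λ c′ → shift^ K (c ∷ a) ≡ c′ ∷ shift^ K a
  shift^-∷ zero    c a = c , refl
  shift^-∷ (suc K) c a = let (c′ , eq) = shift^-∷ K c a in c′ ℤ.+ head₀ (shift^ K a) , cong shift eq

-- Eventually sign-definite Newton coefficients

module _ where
  open import Data.Integer using (+_; -[1+_]; +≤+; +<+)

  Nonneg : List ℤ → Set
  Nonneg = All (0ℤ ℤ.≤_)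

  Nonpos : List ℤ → Set
  Nonpos = All (ℤ._≤ 0ℤ)

  head₀-nonneg : ∀ {a} → Nonneg a → 0ℤ ℤ.≤ head₀ a
  head₀-nonneg []      = ℤ.≤-refl
  head₀-nonneg (c≥0 ∷ _) = c≥0

  shift-nonneg : ∀ {a} → Nonneg a → Nonneg (shift a)
  shift-nonneg []          = []
  shift-nonneg (c≥0 ∷ a≥0) = ℤ.+-mono-≤ c≥0 (head₀-nonneg a≥0) ∷ shift-nonneg a≥0

  shift^-nonneg : ∀ K {a} → Nonneg a → Nonneg (shift^ K a)
  shift^-nonneg zero    a≥0 = a≥0
  shift^-nonneg (suc K) a≥0 = shift-nonneg (shift^-nonneg K a≥0)

  head₀-shift-mono : ∀ {a} → Nonneg a → head₀ a ℤ.≤ head₀ (shift a)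
  head₀-shift-mono []                = ℤ.≤-refl
  head₀-shift-mono {c ∷ a} (_ ∷ a≥0) =
    subst (ℤ._≤ c ℤ.+ head₀ a) (ℤ.+-identityʳ c) (ℤ.+-mono-≤ (ℤ.≤-refl {c}) (head₀-nonneg a≥0))

  head₀-shift^-positive : ∀ t {a} → Nonneg a → 0ℤ ℤ.< head₀ a → 0ℤ ℤ.< head₀ (shift^ t a)
  head₀-shift^-positive zero    a≥0 h>0 = h>0
  head₀-shift^-positive (suc t) a≥0 h>0 =
    ℤ.<-≤-trans (head₀-shift^-positive t a≥0 h>0) (head₀-shift-mono (shift^-nonneg t a≥0))

  zeros-or-positive : ∀ {a} → Nonneg a → All (_≡ 0ℤ) a ⊎ Any (0ℤ ℤ.<_) a
  zeros-or-positive []                          = inj₁ []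
  zeros-or-positive {+ zero ∷ a} (_ ∷ a≥0) with zeros-or-positive a≥0
  ... | inj₁ a≡0 = inj₁ (refl ∷ a≡0)
  ... | inj₂ a>0 = inj₂ (there a>0)
  zeros-or-positive {+ suc n ∷ a} _         = inj₂ (here (+<+ (s≤s z≤n)))

  zeros-nonpos : ∀ {a} → All (_≡ 0ℤ) a → Nonpos a
  zeros-nonpos []           = []
  zeros-nonpos (refl ∷ a≡0) = ℤ.≤-refl ∷ zeros-nonpos a≡0

  eventually-positive-head : ∀ {a} → Nonneg a → Any (0ℤ ℤ.<_) a → ∃ λ K → 0ℤ ℤ.< head₀ (shift^ K a)
  eventually-positive-head _               (here c>0) = 0 , c>0
  eventually-positive-head {c ∷ a} (c≥0 ∷ a≥0) (there a>0) =
    let (K , h>0)  = eventually-positive-head a≥0 a>0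
        (c′ , eq) = shift^-∷ K c a
        c′≥0      = head₀-nonneg (subst Nonneg eq (shift^-nonneg K (c≥0 ∷ a≥0)))
    in suc K , subst (λ b → 0ℤ ℤ.< head₀ (shift b)) (sym eq)
                     (ℤ.<-≤-trans h>0 (subst (ℤ._≤ c′ ℤ.+ head₀ (shift^ K a)) (ℤ.+-identityˡ (head₀ (shift^ K a)))
                                               (ℤ.+-mono-≤ c′≥0 ℤ.≤-refl)))

  head-grows : ∀ t c {a} → Nonneg a → 0ℤ ℤ.< head₀ a → ∃ λ c′ → shift^ t (c ∷ a) ≡ c′ ∷ shift^ t a × c ℤ.+ + t ℤ.≤ c′
  head-grows zero    c a≥0 h>0 = c , refl , ℤ.≤-reflexive (ℤ.+-identityʳ c)
  head-grows (suc t) c {a} a≥0 h>0 =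
    let (c′ , eq , c+t≤c′) = head-grows t c a≥0 h>0
    in c′ ℤ.+ head₀ (shift^ t a) , cong shift eq ,
       subst (ℤ._≤ c′ ℤ.+ head₀ (shift^ t a)) (trans (ℤ.+-assoc c (+ t) (+ 1)) (cong (λ n → c ℤ.+ + n) (+-comm t 1)))
             (ℤ.+-mono-≤ c+t≤c′ (ℤ.i<j⇒suc[i]≤j (head₀-shift^-positive t a≥0 h>0)))

  SignDefinite : List ℤ → Set
  SignDefinite a = ∃ λ K → Nonneg (shift^ K a) ⊎ Nonpos (shift^ K a)

  SignDefinite-shift^ : ∀ K {a} → SignDefinite (shift^ K a) → SignDefinite a
  SignDefinite-shift^ K {a} (K′ , sd) = K′ + K , subst (λ b → Nonneg b ⊎ Nonpos b) (shift^-+ K′ K a) sd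

  -- after ∣ c ∣ shifts the head is at least c + ∣ c ∣ ≥ 0
  nonneg-after-shifts : ∀ c {a} → Nonneg a → 0ℤ ℤ.< head₀ a → Nonneg (shift^ ℤ.∣ c ∣ (c ∷ a))
  nonneg-after-shifts c {a} a≥0 h>0 =
    let (c′ , eq , c+∣c∣≤c′) = head-grows ℤ.∣ c ∣ c a≥0 h>0
    in subst Nonneg (sym eq) (ℤ.≤-trans (c+∣c∣≥0 c) c+∣c∣≤c′ ∷ shift^-nonneg ℤ.∣ c ∣ a≥0)
    where
    c+∣c∣≥0 : ∀ c → 0ℤ ℤ.≤ c ℤ.+ + ℤ.∣ c ∣
    c+∣c∣≥0 (+ n)    = +≤+ z≤n
    c+∣c∣≥0 -[1+ n ] = ℤ.≤-reflexive (sym (ℤ.+-inverseˡ (+ suc n)))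

  sign-definite-∷ : ∀ c {a} → Nonneg a → SignDefinite (c ∷ a)
  sign-definite-∷ c {a} a≥0 with zeros-or-positive a≥0
  ... | inj₁ a≡0 with 0ℤ ℤ.≤? c
  ...   | yes c≥0 = 0 , inj₁ (c≥0 ∷ a≥0)
  ...   | no  c≱0 = 0 , inj₂ (ℤ.<⇒≤ (ℤ.≰⇒> c≱0) ∷ zeros-nonpos a≡0)
  sign-definite-∷ c {a} a≥0 | inj₂ a>0 =
    let (K , h>0)  = eventually-positive-head a≥0 a>0
        (c₁ , eq) = shift^-∷ K c a
    in SignDefinite-shift^ K (subst SignDefinite (sym eq)
         (ℤ.∣ c₁ ∣ , inj₁ (nonneg-after-shifts c₁ (shift^-nonneg K a≥0) h>0)))

  negate : List ℤ → List ℤ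
  negate = map (λ c → ℤ.- c)

  shift-negate : ∀ a → shift (negate a) ≡ negate (shift a)
  shift-negate []      = refl
  shift-negate (c ∷ a) =
    cong₂ _∷_ (trans (cong (λ z → ℤ.- c ℤ.+ z) (head₀-negate a)) (sym (ℤ.neg-distrib-+ c (head₀ a)))) (shift-negate a)
    where
    head₀-negate : ∀ a → head₀ (negate a) ≡ ℤ.- head₀ a
    head₀-negate []      = refl
    head₀-negate (c ∷ a) = refl

  shift^-negate : ∀ K a → shift^ K (negate a) ≡ negate (shift^ K a)
  shift^-negate zero    a = refl
  shift^-negate (suc K) a = trans (cong shift (shift^-negate K a)) (shift-negate (shift^ K a))

  Nonpos⇒Nonneg-negate : ∀ {a} → Nonpos a → Nonneg (negate a)
  Nonpos⇒Nonneg-negate []          = []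
  Nonpos⇒Nonneg-negate (c≤0 ∷ a≤0) = ℤ.neg-mono-≤ c≤0 ∷ Nonpos⇒Nonneg-negate a≤0

  Nonneg-negate⇒Nonpos : ∀ {a} → Nonneg (negate a) → Nonpos a
  Nonneg-negate⇒Nonpos {[]}    []            = []
  Nonneg-negate⇒Nonpos {c ∷ a} (-c≥0 ∷ -a≥0) = ℤ.neg-cancel-≤ -c≥0 ∷ Nonneg-negate⇒Nonpos -a≥0

  Nonpos-negate⇒Nonneg : ∀ {a} → Nonpos (negate a) → Nonneg a
  Nonpos-negate⇒Nonneg {[]}    []            = []
  Nonpos-negate⇒Nonneg {c ∷ a} (-c≤0 ∷ -a≤0) = ℤ.neg-cancel-≤ -c≤0 ∷ Nonpos-negate⇒Nonneg -a≤0

  SignDefinite-negate : ∀ {a} → SignDefinite (negate a) → SignDefinite a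
  SignDefinite-negate {a} (K , sd) with subst (λ b → Nonneg b ⊎ Nonpos b) (shift^-negate K a) sd
  ... | inj₁ -b≥0 = K , inj₂ (Nonneg-negate⇒Nonpos -b≥0)
  ... | inj₂ -b≤0 = K , inj₁ (Nonpos-negate⇒Nonneg -b≤0)

  sign-definite : ∀ a → SignDefinite a
  sign-definite []      = 0 , inj₁ []
  sign-definite (c ∷ a) with sign-definite a
  ... | K , sd = SignDefinite-shift^ K (subst SignDefinite (sym eq) (tail-sign-definite sd))
    where
    c₁ : ℤ
    c₁ = proj₁ (shift^-∷ K c a)
    eq : shift^ K (c ∷ a) ≡ c₁ ∷ shift^ K a
    eq = proj₂ (shift^-∷ K c a)
    tail-sign-definite : Nonneg (shift^ K a) ⊎ Nonpos (shift^ K a) → SignDefinite (c₁ ∷ shift^ K a)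
    tail-sign-definite (inj₁ b≥0) = sign-definite-∷ c₁ b≥0
    tail-sign-definite (inj₂ b≤0) = SignDefinite-negate (sign-definite-∷ (ℤ.- c₁) (Nonpos⇒Nonneg-negate b≤0))

  newtonℤ-nonneg : ∀ {a} → Nonneg a → ∀ m → newtonℤ a m ≡ + newton (map ℤ.∣_∣ a) m
  newtonℤ-nonneg []                  m       = refl
  newtonℤ-nonneg {c ∷ a} (c≥0 ∷ a≥0) zero    =
    sym (trans (cong +_ (trans (cong₂ _+_ (*-identityʳ ℤ.∣ c ∣) (newtonFrom-0 0 (map ℤ.∣_∣ a))) (+-identityʳ _)))
               (ℤ.0≤i⇒+∣i∣≡i c≥0))
  newtonℤ-nonneg {c ∷ a} (c≥0 ∷ a≥0) (suc m) =
    trans (cong₂ ℤ._+_ (newtonℤ-nonneg (c≥0 ∷ a≥0) m) (newtonℤ-nonneg a≥0 m))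
          (cong +_ (sym (newton-suc ℤ.∣ c ∣ (map ℤ.∣_∣ a) m)))

  newtonℤ-nonpos : ∀ {a} → Nonpos a → ∀ m → newtonℤ a m ℤ.≤ 0ℤ
  newtonℤ-nonpos []                  m       = ℤ.≤-refl
  newtonℤ-nonpos (c≤0 ∷ a≤0)         zero    = c≤0
  newtonℤ-nonpos (c≤0 ∷ a≤0)         (suc m) = ℤ.+-mono-≤ (newtonℤ-nonpos (c≤0 ∷ a≤0) m) (newtonℤ-nonpos a≤0 m)

module PositivePart (φ : Poly) (φ-int : IntegerValued φ) where
  open import Data.Integer using (+_; -[1+_]; +≤+)

  value : ℕ → ℤ
  value n = proj₁ (φ-int (+ n))

  positivePart : ℕ → ℕ
  positivePart n = ⌊ value n ⌋₊

  ℕ→ℚ-positivePart : ∀ n → ℕ→ℚ (positivePart n) ≡ evalPoly φ (ℕ→ℚ n) ⊔ 0ℚ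
  ℕ→ℚ-positivePart n = trans (ℕ→ℚ-⌊⌋₊ (value n)) (cong (_⊔ 0ℚ) (sym (proj₂ (φ-int (+ n)))))

  Δˢ^-value : ∀ n → Δˢ^ (length φ) value n ≡ 0ℤ
  Δˢ^-value n = ℤ→ℚ-injective
    (trans (ℤ→ℚ-Δˢ^ (length φ) value (evalPoly φ) (λ n → sym (proj₂ (φ-int (+ n)))) n) (Δ^-evalPoly φ (ℕ→ℚ n)))

  positivePart-newton : ∃ λ N → ∃ λ a → ∀ x → positivePart (N + x) ≡ newton a x
  positivePart-newton with sign-definite (differences (length φ) value)
  ... | K , sd = K , newton-coefficients sd
    where
    coefficients : List ℤ
    coefficients = shift^ K (differences (length φ) value)

    value-newtonℤ : ∀ x → value (K + x) ≡ newtonℤ coefficients x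
    value-newtonℤ x = trans (newton-forward (length φ) value Δˢ^-value (K + x))
                            (sym (newtonℤ-shift^ K (differences (length φ) value) x))

    newton-coefficients : Nonneg coefficients ⊎ Nonpos coefficients →
                          ∃ λ a → ∀ x → positivePart (K + x) ≡ newton a x
    newton-coefficients (inj₁ c≥0) = map ℤ.∣_∣ coefficients , λ x →
      cong ⌊_⌋₊ (trans (value-newtonℤ x) (newtonℤ-nonneg c≥0 x))
    newton-coefficients (inj₂ c≤0) = [] , λ x →
      ⌊⌋₊-nonpos (subst (ℤ._≤ 0ℤ) (sym (value-newtonℤ x)) (newtonℤ-nonpos c≤0 x))
      where
      ⌊⌋₊-nonpos : ∀ {z} → z ℤ.≤ 0ℤ → ⌊ z ⌋₊ ≡ 0
      ⌊⌋₊-nonpos {+ zero}    _        = refl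
      ⌊⌋₊-nonpos {+ suc n}   (+≤+ ())
      ⌊⌋₊-nonpos { -[1+ n ]} _        = refl

lemma20 : (k : ℕ) (f : List (Fin k) → ℕ) (φ : Poly) →
          InSharpFA f → IntegerValued φ →
          ∃ λ (g : List (Fin k) → ℕ) →
            InSharpFA g × (∀ w → ℕ→ℚ (g w) ≡ evalPoly φ (ℕ→ℚ (f w)) ⊔ 0ℚ)
lemma20 k f φ f∈#FA φ-int =
  let (N , a , positivePart≡newton) = positivePart-newton
  in (λ w → positivePart (f w)) , #FA-∘ positivePart N a positivePart≡newton f∈#FA , λ w → ℕ→ℚ-positivePart (f w)
  where open PositivePart φ φ-int
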